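{- Let $r,N$ be nonnegative integers with $r\le N$, and let $p:\mathbb{R}\to\mathbb{R}$ be a polynomial of degree $r$ such that $p(0)=0$ and $|p(i)|\le 2$ for all $i=1,\dots,N$. Then for every $\ell\ge N$ we have $p(\ell)\le 4\ell^r$. -}

module Defs where

open import Level using (0ℓ)
open import Data.Nat using (ℕ; zero; suc)
open import Data.Fin using (Fin; toℕ; fromℕ)
open import Data.Product using (Σ; ∃; _×_; _,_)
open import Data.Sum using (_⊎_)
open import Relation.Binary.PropositionalEquality using (_≡_; _≢_)
open import Relation.Binary.Structures using (IsTotalOrder)
open import Algebra.Structures using (IsCommutativeRing)

-- The real numbers, axiomatised as a Dedekind-complete ordered field
-- (any model is isomorphic to ℝ).  Equality is propositional equality.
record RealNumbers : Set₁ where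
  infixl 6 _+_
  infixl 7 _*_
  infix 4 _≤_
  field
    Carrier : Set
    _+_ _*_ : Carrier → Carrier → Carrier
    -_ : Carrier → Carrier
    0# 1# : Carrier
    _≤_ : Carrier → Carrier → Set
    isCommutativeRing : IsCommutativeRing _≡_ _+_ _*_ -_ 0# 1#
    isTotalOrder : IsTotalOrder _≡_ _≤_
    0≢1 : 0# ≢ 1#
    inverse : ∀ x → x ≢ 0# → Σ Carrier λ y → x * y ≡ 1#
    +-mono-≤ : ∀ {x y} z → x ≤ y → x + z ≤ y + z
    *-nonneg : ∀ {x y} → 0# ≤ x → 0# ≤ y → 0# ≤ x * y
    sup : (P : Carrier → Set) → (∃ P) → (Σ Carrier λ b → ∀ x → P x → x ≤ b) →
          Σ Carrier λ s → (∀ x → P x → x ≤ s) × (∀ b → (∀ x → P x → x ≤ b) → s ≤ b)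

module RealOps (R : RealNumbers) where
  open RealNumbers R

  fromℕ' : ℕ → Carrier
  fromℕ' zero = 0#
  fromℕ' (suc n) = 1# + fromℕ' n

  _^_ : Carrier → ℕ → Carrier
  x ^ zero = 1#
  x ^ suc n = x * (x ^ n)

  sumFin : (n : ℕ) → (Fin n → Carrier) → Carrier
  sumFin zero f = 0#
  sumFin (suc n) f = f Fin.zero + sumFin n (λ i → f (Fin.suc i))

  IsPolyOfDegree : (Carrier → Carrier) → ℕ → Set
  IsPolyOfDegree p r =
    Σ (Fin (suc r) → Carrier) λ c →
      (c (fromℕ r) ≢ 0#) × (∀ x → p x ≡ sumFin (suc r) (λ i → c i * (x ^ toℕ i)))

  AbsLe : Carrier → Carrier → Set
  AbsLe y b = (- b ≤ y) × (y ≤ b)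

-- Lagrange interpolation at the nodes 0, …, r.  A polynomial p of degree at most r satisfies
--   r! · p(ℓ) = Σᵢ p(i) · C(r,i) · ∏_{j<i} (ℓ − j) · ∏_{i<j≤r} (j − ℓ),
-- proved on ℕ by finite differences: the difference of the two sides is killed by Δ^{r+1} and
-- vanishes at 0, …, r, hence everywhere.  For ℓ ≥ r the two products together are ± a natural
-- number at most ℓ^r, so |p(i)| ≤ 2 on the nodes (p(0) = 0 included) gives
--   r! · p(ℓ) ≤ 2 · Σᵢ C(r,i) · ℓ^r = 2^{r+1} · ℓ^r ≤ 4 · r! · ℓ^r.

module Submission where

open import Level using (0ℓ)
open import Function using (_∘_)
open import Data.Empty using (⊥-elim)
open import Data.Product using (Σ; _×_; _,_; proj₂)
open import Data.Sum using (_⊎_; inj₁; inj₂)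
open import Data.Nat as ℕ using (ℕ; zero; suc; _∸_; _!; z≤n; s≤s)
import Data.Nat.Properties as ℕ
open import Data.Nat.Combinatorics using (_C_)
open import Data.Nat.Combinatorics.Base using (_P′_)
open import Data.Nat.Combinatorics.Specification using (nP′n≡n!)
open import Data.Fin as Fin using (Fin; toℕ; punchIn)
open import Data.Fin.Properties using (toℕ<n; toℕ≤pred[n]; toℕ-fromℕ<; toℕ-injective; punchInᵢ≢i)
open import Relation.Nullary using (¬_)
open import Relation.Binary.PropositionalEquality as ≡ using (_≡_; _≢_)
open import Relation.Binary.Definitions using (tri<; tri≈; tri>)
open import Relation.Binary.Structures using (IsTotalOrder)
open import Relation.Binary.Bundles using (Poset)
import Relation.Binary.Reasoning.PartialOrder
open import Algebra.Bundles using (CommutativeRing)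
import Algebra.Properties.Semiring.Sum as SemiringSum
open import Defs

module ℕΣ = SemiringSum ℕ.+-*-semiring

module NatCombinatorics where

  open import Data.Nat using (_≤_; _*_; _^_)
  open import Data.Nat.Combinatorics using (nCk≡n!/k![n-k]!; k![n∸k]!∣n!)
  open import Data.Nat.DivMod using (m/n*n≡m)
  open import Relation.Binary.PropositionalEquality using (refl; cong; sym; trans)
  import Algebra.Properties.Semiring.Mult as SemiringMult
  import Algebra.Properties.Semiring.Exp as SemiringExp
  import Algebra.Properties.CommutativeSemiring.Binomial as Binomial

  nCk*[k!*[n∸k]!]≡n! : ∀ {n k} → k ≤ n → (n C k) * (k ! * (n ∸ k) !) ≡ n !
  nCk*[k!*[n∸k]!]≡n! {n} {k} k≤n =
    trans (cong (_* (k ! * (n ∸ k) !)) (nCk≡n!/k![n-k]! k≤n))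
          (m/n*n≡m {{k ℕ.!* (n ∸ k) !≢0}} (k![n∸k]!∣n! k≤n))

  nP′k≤n^k : ∀ n k → n P′ k ≤ n ^ k
  nP′k≤n^k n zero    = ℕ.≤-refl
  nP′k≤n^k n (suc k) = ℕ.*-mono-≤ (ℕ.m∸n≤m n k) (nP′k≤n^k n k)

  ∑nCk≡2^n : ∀ n → ℕΣ.sum (λ (k : Fin (suc n)) → n C toℕ k) ≡ 2 ^ n
  ∑nCk≡2^n n = begin
    ℕΣ.sum {suc n} (λ k → n C toℕ k)        ≡⟨ ℕΣ.sum-cong-≗ (λ k → sym (binomialTerm[1,1]≡nCk k)) ⟩
    binomialExpansion 1 1 n                 ≡⟨ sym (theorem n 1 1) ⟩
    2 ^ₛ n                                  ≡⟨ ^ₛ≡^ 2 n ⟩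
    2 ^ n                                   ∎
    where
    open ≡.≡-Reasoning
    open Binomial ℕ.+-*-commutativeSemiring using (theorem; binomialExpansion)
    open SemiringExp ℕ.+-*-semiring using () renaming (_^_ to _^ₛ_)
    open SemiringMult ℕ.+-*-semiring using () renaming (_×_ to _×ₛ_)
    ^ₛ≡^ : ∀ x m → x ^ₛ m ≡ x ^ m
    ^ₛ≡^ x zero    = refl
    ^ₛ≡^ x (suc m) = cong (x *_) (^ₛ≡^ x m)
    1^ₛm≡1 : ∀ m → 1 ^ₛ m ≡ 1
    1^ₛm≡1 m = trans (^ₛ≡^ 1 m) (ℕ.^-zeroˡ m)
    m×ₛ1≡m : ∀ m → m ×ₛ 1 ≡ m
    m×ₛ1≡m zero    = refl
    m×ₛ1≡m (suc m) = cong suc (m×ₛ1≡m m)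
    binomialTerm[1,1]≡nCk : ∀ (k : Fin (suc n)) →
                            (n C toℕ k) ×ₛ (1 ^ₛ toℕ k * 1 ^ₛ (n ∸ toℕ k)) ≡ n C toℕ k
    binomialTerm[1,1]≡nCk k =
      trans (cong ((n C toℕ k) ×ₛ_) (≡.cong₂ _*_ (1^ₛm≡1 (toℕ k)) (1^ₛm≡1 (n ∸ toℕ k))))
            (m×ₛ1≡m (n C toℕ k))

  2*2^n≤4*n! : ∀ n → 2 * 2 ^ n ≤ 4 * n !
  2*2^n≤4*n! zero          = s≤s (s≤s z≤n)
  2*2^n≤4*n! (suc zero)    = ℕ.≤-refl
  2*2^n≤4*n! (suc (suc n)) = begin
    2 * (2 * 2 ^ suc n)       ≤⟨ ℕ.*-mono-≤ {2} {suc (suc n)} (s≤s (s≤s z≤n)) (2*2^n≤4*n! (suc n)) ⟩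
    suc (suc n) * (4 * suc n !)  ≡⟨ ℕ.*-assoc (suc (suc n)) 4 (suc n !) ⟨
    suc (suc n) * 4 * suc n !    ≡⟨ cong (_* suc n !) (ℕ.*-comm (suc (suc n)) 4) ⟩
    4 * suc (suc n) * suc n !    ≡⟨ ℕ.*-assoc 4 (suc (suc n)) (suc n !) ⟩
    4 * suc (suc n) !            ∎
    where open ℕ.≤-Reasoning

open NatCombinatorics

module Interpolation {c ℓ} (R : CommutativeRing c ℓ) where

  open import Data.Nat using (_<_; _≤_)
  open CommutativeRing R hiding (zero)
  open import Algebra.Properties.Ring ring using (-‿distribˡ-*; -‿distribʳ-*; -‿involutive; -1*x≈-x)
  open import Algebra.Properties.AbelianGroup +-abelianGroup
    using (⁻¹-∙-comm; ⁻¹-anti-homo-//; //-rightDividesˡ; //-rightDividesʳ; x∙y⁻¹≈ε⇒x≈y)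
  open import Algebra.Properties.Semiring.Mult semiring using (×-homo-+; ×1-homo-*) renaming (_×_ to _⋆_)
  open import Algebra.Properties.Semiring.Exp semiring using (_^_)
  open import Algebra.Properties.Semiring.Sum semiring
    using (sum; sum-remove; sum-cong-≋; sum-replicate-zero)
  open import Data.Vec.Functional using (removeAt)
  open import Algebra.Solver.Ring.NaturalCoefficients.Default commutativeSemiring
    using (solve; _:+_; _:*_; _:=_)
  open import Relation.Binary.Reasoning.Setoid setoid
  import Algebra.Properties.CommutativeSemigroup ℕ.*-commutativeSemigroup as ℕ*

  ι : ℕ → Carrier
  ι n = n ⋆ 1#

  -‿distrib-+ : ∀ x y → - (x + y) ≈ - x + - y
  -‿distrib-+ x y = sym (⁻¹-∙-comm x y)

  Δ : (ℕ → Carrier) → ℕ → Carrier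
  Δ f n = f (suc n) - f n

  Δ^ : ℕ → (ℕ → Carrier) → ℕ → Carrier
  Δ^ zero    f = f
  Δ^ (suc d) f = Δ^ d (Δ f)

  Δ^-cong : ∀ d {f g} → (∀ n → f n ≈ g n) → ∀ n → Δ^ d f n ≈ Δ^ d g n
  Δ^-cong zero    f≈g = f≈g
  Δ^-cong (suc d) f≈g = Δ^-cong d (λ n → +-cong (f≈g (suc n)) (-‿cong (f≈g n)))

  Δ^-Δ : ∀ d f n → Δ^ d (Δ f) n ≡ Δ (Δ^ d f) n
  Δ^-Δ zero    f n = ≡.refl
  Δ^-Δ (suc d) f n = Δ^-Δ d (Δ f) n

  Δ^-shift : ∀ d f n → Δ^ d (f ∘ suc) n ≡ Δ^ d f (suc n)
  Δ^-shift zero    f n = ≡.refl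
  Δ^-shift (suc d) f n = Δ^-shift d (Δ f) n

  -- The semiring solver treats the negated values (- f₀, - g₀ here) as atoms.
  Δ-lincomb : ∀ a b f g n → Δ (λ m → a * f m + b * g m) n ≈ a * Δ f n + b * Δ g n
  Δ-lincomb a b f g n = begin
    (a * f₁ + b * g₁) - (a * f₀ + b * g₀)
      ≈⟨ +-congˡ (trans (-‿distrib-+ _ _) (+-cong (-‿distribʳ-* a f₀) (-‿distribʳ-* b g₀))) ⟩
    (a * f₁ + b * g₁) + (a * - f₀ + b * - g₀)
      ≈⟨ solve 6 (λ a b f₁ f₀ g₁ g₀ → (a :* f₁ :+ b :* g₁) :+ (a :* f₀ :+ b :* g₀)
                                   := a :* (f₁ :+ f₀) :+ b :* (g₁ :+ g₀))
                 refl a b f₁ (- f₀) g₁ (- g₀) ⟩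
    a * (f₁ - f₀) + b * (g₁ - g₀)
      ∎
    where
    f₀ f₁ g₀ g₁ : Carrier
    f₀ = f n; f₁ = f (suc n); g₀ = g n; g₁ = g (suc n)

  Δ^-lincomb : ∀ d a b f g n → Δ^ d (λ m → a * f m + b * g m) n ≈ a * Δ^ d f n + b * Δ^ d g n
  Δ^-lincomb zero    a b f g n = refl
  Δ^-lincomb (suc d) a b f g n =
    trans (Δ^-cong d (Δ-lincomb a b f g) n) (Δ^-lincomb d a b (Δ f) (Δ g) n)

  record Degree< (d : ℕ) (f : ℕ → Carrier) : Set ℓ where
    constructor degree<
    field Δ^≈0 : ∀ n → Δ^ d f n ≈ 0#

  Degree<-cong : ∀ {d f g} → (∀ n → f n ≈ g n) → Degree< d f → Degree< d g
  Degree<-cong {d} f≈g (degree< z) = degree< λ n → trans (sym (Δ^-cong d f≈g n)) (z n)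

  Degree<-lincomb : ∀ {d f g} a b → Degree< d f → Degree< d g → Degree< d (λ n → a * f n + b * g n)
  Degree<-lincomb {d} {f} {g} a b (degree< zf) (degree< zg) = degree< λ n → begin
    Δ^ d (λ m → a * f m + b * g m) n ≈⟨ Δ^-lincomb d a b f g n ⟩
    a * Δ^ d f n + b * Δ^ d g n      ≈⟨ +-cong (*-congˡ (zf n)) (*-congˡ (zg n)) ⟩
    a * 0# + b * 0#                  ≈⟨ +-cong (zeroʳ a) (zeroʳ b) ⟩
    0# + 0#                          ≈⟨ +-identityʳ 0# ⟩
    0#                               ∎

  Degree<-+ : ∀ {d f g} → Degree< d f → Degree< d g → Degree< d (λ n → f n + g n)
  Degree<-+ df dg =
    Degree<-cong (λ n → +-cong (*-identityˡ _) (*-identityˡ _)) (Degree<-lincomb 1# 1# df dg)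

  Degree<-- : ∀ {d f g} → Degree< d f → Degree< d g → Degree< d (λ n → f n - g n)
  Degree<-- df dg =
    Degree<-cong (λ n → +-cong (*-identityˡ _) (-1*x≈-x _)) (Degree<-lincomb 1# (- 1#) df dg)

  Degree<-scale : ∀ {d f} a → Degree< d f → Degree< d (λ n → a * f n)
  Degree<-scale a df =
    Degree<-cong (λ n → trans (+-congˡ (zeroˡ _)) (+-identityʳ _)) (Degree<-lincomb a 0# df df)

  Degree<-Δ : ∀ {d f} → Degree< (suc d) f → Degree< d (Δ f)
  Degree<-Δ (degree< z) = degree< z

  Degree<-unΔ : ∀ {d f} → Degree< d (Δ f) → Degree< (suc d) f
  Degree<-unΔ (degree< z) = degree< z

  Degree<-0 : ∀ {d} → Degree< d (λ _ → 0#)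
  Degree<-0 {zero}  = degree< λ _ → refl
  Degree<-0 {suc d} = Degree<-unΔ (Degree<-cong (λ _ → sym (-‿inverseʳ 0#)) (Degree<-0 {d}))

  Degree<-const : ∀ a → Degree< 1 (λ _ → a)
  Degree<-const a = degree< λ _ → -‿inverseʳ a

  Degree<-suc : ∀ {d f} → Degree< d f → Degree< (suc d) f
  Degree<-suc {d} {f} (degree< z) = degree< λ n → begin
    Δ^ d (Δ f) n                  ≡⟨ Δ^-Δ d f n ⟩
    Δ^ d f (suc n) - Δ^ d f n     ≈⟨ +-cong (z (suc n)) (-‿cong (z n)) ⟩
    0# - 0#                       ≈⟨ -‿inverseʳ 0# ⟩
    0#                            ∎

  Degree<-mono : ∀ {d e f} → d ≤ e → Degree< d f → Degree< e f
  Degree<-mono d≤e = go (ℕ.≤⇒≤′ d≤e)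
    where
    go : ∀ {d e f} → d ℕ.≤′ e → Degree< d f → Degree< e f
    go ℕ.≤′-refl        df = df
    go (ℕ.≤′-step d≤′e) df = Degree<-suc (go d≤′e df)

  Degree<-shift : ∀ {d f} → Degree< d f → Degree< d (f ∘ suc)
  Degree<-shift {d} {f} (degree< z) = degree< λ n → ≡.subst (_≈ 0#) (≡.sym (Δ^-shift d f n)) (z (suc n))

  Degree<-sum : ∀ {d k} (F : Fin k → ℕ → Carrier) → (∀ i → Degree< d (F i)) →
                Degree< d (λ n → sum (λ i → F i n))
  Degree<-sum {k = zero}  F dF = Degree<-0
  Degree<-sum {k = suc k} F dF = Degree<-+ (dF Fin.zero) (Degree<-sum (F ∘ Fin.suc) (dF ∘ Fin.suc))

  Degree<-zero-on-prefix⇒zero : ∀ d {h} → Degree< d h → (∀ m → m < d → h m ≈ 0#) → ∀ n → h n ≈ 0#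
  Degree<-zero-on-prefix⇒zero zero    (degree< z) _ = z
  Degree<-zero-on-prefix⇒zero (suc d) {h} dh h≈0 = go
    where
    Δh≈0 : ∀ n → Δ h n ≈ 0#
    Δh≈0 = Degree<-zero-on-prefix⇒zero d (Degree<-Δ dh) λ m m<d →
      trans (+-cong (h≈0 (suc m) (s≤s m<d)) (-‿cong (h≈0 m (ℕ.m<n⇒m<1+n m<d)))) (-‿inverseʳ 0#)
    go : ∀ n → h n ≈ 0#
    go zero    = h≈0 zero (s≤s z≤n)
    go (suc n) = begin
      h (suc n)           ≈⟨ //-rightDividesˡ (h n) (h (suc n)) ⟨
      Δ h n + h n         ≈⟨ +-cong (Δh≈0 n) (go n) ⟩
      0# + 0#             ≈⟨ +-identityʳ 0# ⟩
      0#                  ∎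

  Δ-*-affine : ∀ α β g n → Δ (λ m → (α * ι m + β) * g m) n ≈ (α * ι n + β) * Δ g n + α * g (suc n)
  Δ-*-affine α β g n = begin
    (α * (1# + x) + β) * g₁ - (α * x + β) * g₀
      ≈⟨ +-cong (*-congʳ (+-congʳ α[1+x])) (-‿distribʳ-* _ g₀) ⟩
    (α + α * x + β) * g₁ + (α * x + β) * - g₀
      ≈⟨ solve 5 (λ α x β g₁ g₀ → (α :+ α :* x :+ β) :* g₁ :+ (α :* x :+ β) :* g₀
                                := (α :* x :+ β) :* (g₁ :+ g₀) :+ α :* g₁)
                 refl α x β g₁ (- g₀) ⟩
    (α * x + β) * (g₁ - g₀) + α * g₁
      ∎
    where
    x g₀ g₁ : Carrier
    x = ι n; g₀ = g n; g₁ = g (suc n)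
    α[1+x] : α * (1# + x) ≈ α + α * x
    α[1+x] = trans (distribˡ α 1# x) (+-congʳ (*-identityʳ α))

  Degree<-*-affine : ∀ {d g} α β → Degree< d g → Degree< (suc d) (λ n → (α * ι n + β) * g n)
  Degree<-*-affine {zero}  α β (degree< z) =
    Degree<-cong (λ n → sym (trans (*-congˡ (z n)) (zeroʳ _))) Degree<-0
  Degree<-*-affine {suc d} {g} α β dg = Degree<-unΔ (Degree<-cong (λ n → sym (Δ-*-affine α β g n))
    (Degree<-+ (Degree<-*-affine α β (Degree<-Δ dg)) (Degree<-scale α (Degree<-shift dg))))

  Degree<-^ : ∀ k → Degree< (suc k) (λ n → ι n ^ k)
  Degree<-^ zero    = Degree<-const 1#
  Degree<-^ (suc k) = Degree<-cong (λ n → *-congʳ (trans (+-identityʳ _) (*-identityˡ _)))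
                                   (Degree<-*-affine 1# 0# (Degree<-^ k))

  Degree<-polynomial : ∀ r (a : Fin (suc r) → Carrier) →
                       Degree< (suc r) (λ n → sum (λ i → a i * ι n ^ toℕ i))
  Degree<-polynomial r a = Degree<-sum _ λ i →
    Degree<-scale (a i) (Degree<-mono (toℕ<n i) (Degree<-^ (toℕ i)))

  ι-+ : ∀ m n → ι (m ℕ.+ n) ≈ ι m + ι n
  ι-+ = ×-homo-+ 1#

  ι-* : ∀ m n → ι (m ℕ.* n) ≈ ι m * ι n
  ι-* = ×1-homo-*

  ι-∸ : ∀ {m n} → n ≤ m → ι (m ∸ n) ≈ ι m - ι n
  ι-∸ {m} {n} n≤m = begin
    ι (m ∸ n)                 ≈⟨ //-rightDividesʳ (ι n) (ι (m ∸ n)) ⟨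
    ι (m ∸ n) + ι n - ι n     ≈⟨ +-congʳ (ι-+ (m ∸ n) n) ⟨
    ι (m ∸ n ℕ.+ n) - ι n     ≡⟨ ≡.cong (λ k → ι k - ι n) (ℕ.m∸n+n≡m n≤m) ⟩
    ι m - ι n                 ∎

  ι-^ : ∀ m n → ι (m ℕ.^ n) ≈ ι m ^ n
  ι-^ m zero    = +-identityʳ 1#
  ι-^ m (suc n) = trans (ι-* m (m ℕ.^ n)) (*-congˡ (ι-^ m n))

  ι-sum : ∀ {k} (b : Fin k → ℕ) → ι (ℕΣ.sum b) ≈ sum (ι ∘ b)
  ι-sum {zero}  b = refl
  ι-sum {suc k} b = trans (ι-+ (b Fin.zero) _) (+-congˡ (ι-sum (b ∘ Fin.suc)))

  infix 4 _≈±ι_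
  _≈±ι_ : Carrier → ℕ → Set ℓ
  x ≈±ι k = x ≈ ι k ⊎ x ≈ - ι k

  ≈±ι-* : ∀ {x y m n} → x ≈±ι m → y ≈±ι n → x * y ≈±ι (m ℕ.* n)
  ≈±ι-* {m = m} {n} (inj₁ x≈) (inj₁ y≈) = inj₁ (trans (*-cong x≈ y≈) (sym (ι-* m n)))
  ≈±ι-* {m = m} {n} (inj₁ x≈) (inj₂ y≈) =
    inj₂ (trans (*-cong x≈ y≈) (trans (sym (-‿distribʳ-* _ _)) (-‿cong (sym (ι-* m n)))))
  ≈±ι-* {m = m} {n} (inj₂ x≈) (inj₁ y≈) =
    inj₂ (trans (*-cong x≈ y≈) (trans (sym (-‿distribˡ-* _ _)) (-‿cong (sym (ι-* m n)))))
  ≈±ι-* {m = m} {n} (inj₂ x≈) (inj₂ y≈) = inj₁ (begin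
    _ * _              ≈⟨ *-cong x≈ y≈ ⟩
    - ι m * - ι n      ≈⟨ -‿distribˡ-* _ _ ⟨
    - (ι m * - ι n)    ≈⟨ -‿cong (-‿distribʳ-* _ _) ⟨
    - - (ι m * ι n)    ≈⟨ -‿involutive _ ⟩
    ι m * ι n          ≈⟨ ι-* m n ⟨
    ι (m ℕ.* n)        ∎)

  fallingFactorial : Carrier → ℕ → Carrier
  fallingFactorial x zero    = 1#
  fallingFactorial x (suc i) = (x - ι i) * fallingFactorial x i

  fallingFactorial-vanishes : ∀ {m} i → m < i → fallingFactorial (ι m) i ≈ 0#
  fallingFactorial-vanishes {m} (suc i) (s≤s m≤i) with ℕ.m≤n⇒m<n∨m≡n m≤i
  ... | inj₁ m<i    = trans (*-congˡ (fallingFactorial-vanishes i m<i)) (zeroʳ _)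
  ... | inj₂ ≡.refl = trans (*-congʳ (-‿inverseʳ (ι m))) (zeroˡ _)

  fallingFactorial-ι : ∀ {n} i → i ≤ n → fallingFactorial (ι n) i ≈ ι (n P′ i)
  fallingFactorial-ι         zero    _   = sym (+-identityʳ 1#)
  fallingFactorial-ι {n} (suc i) i<n = begin
    (ι n - ι i) * fallingFactorial (ι n) i   ≈⟨ *-cong (sym (ι-∸ i≤n)) (fallingFactorial-ι i i≤n) ⟩
    ι (n ∸ i) * ι (n P′ i)                   ≈⟨ ι-* (n ∸ i) (n P′ i) ⟨
    ι (n P′ suc i)                           ∎
    where
    i≤n : i ≤ n
    i≤n = ℕ.<⇒≤ i<n

  Degree<-fallingFactorial : ∀ i → Degree< (suc i) (λ n → fallingFactorial (ι n) i)
  Degree<-fallingFactorial zero    = Degree<-const 1#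
  Degree<-fallingFactorial (suc i) =
    Degree<-cong (λ n → *-congʳ (+-congʳ (*-identityˡ _)))
                 (Degree<-*-affine 1# (- ι i) (Degree<-fallingFactorial i))

  lagrangeNumerator : Carrier → ℕ → ℕ → Carrier
  lagrangeNumerator x i zero    = fallingFactorial x i
  lagrangeNumerator x i (suc k) = (ι (i ℕ.+ suc k) - x) * lagrangeNumerator x i k

  Degree<-lagrangeNumerator : ∀ i k → Degree< (suc (i ℕ.+ k)) (λ n → lagrangeNumerator (ι n) i k)
  Degree<-lagrangeNumerator i zero    =
    ≡.subst (λ d → Degree< (suc d) (λ n → fallingFactorial (ι n) i)) (≡.sym (ℕ.+-identityʳ i))
            (Degree<-fallingFactorial i)
  Degree<-lagrangeNumerator i (suc k) =
    ≡.subst (λ d → Degree< (suc d) (λ n → lagrangeNumerator (ι n) i (suc k))) (≡.sym (ℕ.+-suc i k))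
      (Degree<-cong (λ n → *-congʳ (trans (+-congʳ (-1*x≈-x (ι n))) (+-comm _ _)))
                    (Degree<-*-affine (- 1#) (ι (i ℕ.+ suc k)) (Degree<-lagrangeNumerator i k)))

  lagrangeNumerator-vanishes-below : ∀ {m i} k → m < i → lagrangeNumerator (ι m) i k ≈ 0#
  lagrangeNumerator-vanishes-below {i = i} zero    m<i = fallingFactorial-vanishes i m<i
  lagrangeNumerator-vanishes-below         (suc k) m<i =
    trans (*-congˡ (lagrangeNumerator-vanishes-below k m<i)) (zeroʳ _)

  lagrangeNumerator-vanishes-above : ∀ {m i} k → i < m → m ≤ i ℕ.+ k → lagrangeNumerator (ι m) i k ≈ 0#
  lagrangeNumerator-vanishes-above {m} {i} zero    i<m m≤i+0 =
    ⊥-elim (ℕ.<⇒≱ i<m (≡.subst (m ≤_) (ℕ.+-identityʳ i) m≤i+0))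
  lagrangeNumerator-vanishes-above {m} {i} (suc k) i<m m≤i+1+k
    with ℕ.m≤n⇒m<n∨m≡n (≡.subst (m ≤_) (ℕ.+-suc i k) m≤i+1+k)
  ... | inj₁ m<1+i+k =
    trans (*-congˡ (lagrangeNumerator-vanishes-above k i<m (ℕ.≤-pred m<1+i+k))) (zeroʳ _)
  ... | inj₂ m≡1+i+k = trans (*-congʳ factor≈0) (zeroˡ _)
    where
    factor≈0 : ι (i ℕ.+ suc k) - ι m ≈ 0#
    factor≈0 = trans (+-congʳ (reflexive (≡.cong ι (≡.trans (ℕ.+-suc i k) (≡.sym m≡1+i+k)))))
                     (-‿inverseʳ (ι m))

  lagrangeNumerator-diagonal : ∀ i k → lagrangeNumerator (ι i) i k ≈ ι (i ! ℕ.* k !)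
  lagrangeNumerator-diagonal i zero    = begin
    fallingFactorial (ι i) i   ≈⟨ fallingFactorial-ι i ℕ.≤-refl ⟩
    ι (i P′ i)                 ≡⟨ ≡.cong ι (≡.trans (nP′n≡n! i) (≡.sym (ℕ.*-identityʳ (i !)))) ⟩
    ι (i ! ℕ.* 1)              ∎
  lagrangeNumerator-diagonal i (suc k) = begin
    (ι (i ℕ.+ suc k) - ι i) * lagrangeNumerator (ι i) i k ≈⟨ *-cong gap (lagrangeNumerator-diagonal i k) ⟩
    ι (suc k) * ι (i ! ℕ.* k !)                          ≈⟨ ι-* (suc k) (i ! ℕ.* k !) ⟨
    ι (suc k ℕ.* (i ! ℕ.* k !))                          ≡⟨ ≡.cong ι (ℕ*.x∙yz≈y∙xz (suc k) (i !) (k !)) ⟩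
    ι (i ! ℕ.* suc k !)                                  ∎
    where
    gap : ι (i ℕ.+ suc k) - ι i ≈ ι (suc k)
    gap = trans (sym (ι-∸ (ℕ.m≤m+n i (suc k)))) (reflexive (≡.cong ι (ℕ.m+n∸m≡n i (suc k))))

  lagrangeNumerator-≈±ι : ∀ {n} i k → i ℕ.+ k ≤ n →
    Σ ℕ λ m → m ≤ n ℕ.^ (i ℕ.+ k) × lagrangeNumerator (ι n) i k ≈±ι m
  lagrangeNumerator-≈±ι {n} i zero    i+0≤n =
    n P′ i , ≡.subst (λ e → n P′ i ≤ n ℕ.^ e) (≡.sym (ℕ.+-identityʳ i)) (nP′k≤n^k n i) ,
    inj₁ (fallingFactorial-ι i (≡.subst (_≤ n) (ℕ.+-identityʳ i) i+0≤n))
  lagrangeNumerator-≈±ι {n} i (suc k) i+1+k≤n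
    with lagrangeNumerator-≈±ι i k (ℕ.≤-trans (ℕ.+-monoʳ-≤ i (ℕ.n≤1+n k)) i+1+k≤n)
  ... | m , m≤n^[i+k] , numerator≈±m =
    (n ∸ (i ℕ.+ suc k)) ℕ.* m ,
    ≡.subst (λ e → (n ∸ (i ℕ.+ suc k)) ℕ.* m ≤ n ℕ.^ e) (≡.sym (ℕ.+-suc i k))
            (ℕ.*-mono-≤ (ℕ.m∸n≤m n (i ℕ.+ suc k)) m≤n^[i+k]) ,
    ≈±ι-* {m = n ∸ (i ℕ.+ suc k)} (inj₂ factor≈) numerator≈±m
    where
    factor≈ : ι (i ℕ.+ suc k) - ι n ≈ - ι (n ∸ (i ℕ.+ suc k))
    factor≈ = sym (trans (-‿cong (ι-∸ i+1+k≤n)) (⁻¹-anti-homo-// (ι n) _))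

  -- r! · Lᵢ(x), for Lᵢ the Lagrange basis polynomial of the node i among 0, …, r.  Taking the
  -- factors j − x (not x − j) for j > i makes the value at i exactly i! (r − i)!, with no sign.
  lagrangeBasis : ℕ → ℕ → Carrier → Carrier
  lagrangeBasis r i x = ι (r C i) * lagrangeNumerator x i (r ∸ i)

  Degree<-lagrangeBasis : ∀ {r i} → i ≤ r → Degree< (suc r) (λ n → lagrangeBasis r i (ι n))
  Degree<-lagrangeBasis {r} {i} i≤r = Degree<-scale (ι (r C i))
    (≡.subst (λ d → Degree< (suc d) (λ n → lagrangeNumerator (ι n) i (r ∸ i))) (ℕ.m+[n∸m]≡n i≤r)
             (Degree<-lagrangeNumerator i (r ∸ i)))

  lagrangeBasis-diagonal : ∀ {r i} → i ≤ r → lagrangeBasis r i (ι i) ≈ ι (r !)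
  lagrangeBasis-diagonal {r} {i} i≤r = begin
    ι (r C i) * lagrangeNumerator (ι i) i (r ∸ i)   ≈⟨ *-congˡ (lagrangeNumerator-diagonal i (r ∸ i)) ⟩
    ι (r C i) * ι (i ! ℕ.* (r ∸ i) !)               ≈⟨ ι-* (r C i) _ ⟨
    ι ((r C i) ℕ.* (i ! ℕ.* (r ∸ i) !))             ≡⟨ ≡.cong ι (nCk*[k!*[n∸k]!]≡n! i≤r) ⟩
    ι (r !)                                         ∎

  lagrangeBasis-off-diagonal : ∀ {r i m} → i ≤ r → m ≤ r → m ≢ i → lagrangeBasis r i (ι m) ≈ 0#
  lagrangeBasis-off-diagonal {r} {i} {m} i≤r m≤r m≢i = trans (*-congˡ numerator≈0) (zeroʳ _)
    where
    numerator≈0 : lagrangeNumerator (ι m) i (r ∸ i) ≈ 0#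
    numerator≈0 with ℕ.<-cmp m i
    ... | tri< m<i _ _ = lagrangeNumerator-vanishes-below (r ∸ i) m<i
    ... | tri≈ _ m≡i _ = ⊥-elim (m≢i m≡i)
    ... | tri> _ _ i<m = lagrangeNumerator-vanishes-above (r ∸ i) i<m
                           (≡.subst (m ≤_) (≡.sym (ℕ.m+[n∸m]≡n i≤r)) m≤r)

  lagrangeBasis-≈±ι : ∀ {r i n} → i ≤ r → r ≤ n →
    Σ ℕ λ m → m ≤ (r C i) ℕ.* n ℕ.^ r × lagrangeBasis r i (ι n) ≈±ι m
  lagrangeBasis-≈±ι {r} {i} {n} i≤r r≤n
    with lagrangeNumerator-≈±ι {n} i (r ∸ i) (≡.subst (_≤ n) (≡.sym (ℕ.m+[n∸m]≡n i≤r)) r≤n)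
  ... | m , m≤ , numerator≈±m =
    (r C i) ℕ.* m ,
    ℕ.*-monoʳ-≤ (r C i) (≡.subst (λ e → m ≤ n ℕ.^ e) (ℕ.m+[n∸m]≡n i≤r) m≤) ,
    ≈±ι-* {m = r C i} (inj₁ refl) numerator≈±m

  sum-single : ∀ {k} (t : Fin (suc k) → Carrier) i → (∀ j → j ≢ i → t j ≈ 0#) → sum t ≈ t i
  sum-single {k} t i t≈0 = begin
    sum t                      ≈⟨ sum-remove {i = i} t ⟩
    t i + sum (removeAt t i)   ≈⟨ +-congˡ (trans (sum-cong-≋ λ j → t≈0 (punchIn i j) (punchInᵢ≢i i j))
                                                (sum-replicate-zero k)) ⟩
    t i + 0#                   ≈⟨ +-identityʳ (t i) ⟩
    t i                        ∎

  lagrange-interpolation : ∀ r {f} → Degree< (suc r) f → ∀ n →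
    ι (r !) * f n ≈ sum (λ (i : Fin (suc r)) → f (toℕ i) * lagrangeBasis r (toℕ i) (ι n))
  lagrange-interpolation r {f} df n =
    x∙y⁻¹≈ε⇒x≈y _ _ (Degree<-zero-on-prefix⇒zero (suc r) Degree<-error error-at-nodes n)
    where
    interpolant : ℕ → Carrier
    interpolant n = sum {suc r} (λ i → f (toℕ i) * lagrangeBasis r (toℕ i) (ι n))

    Degree<-error : Degree< (suc r) (λ n → ι (r !) * f n - interpolant n)
    Degree<-error = Degree<-- (Degree<-scale (ι (r !)) df) (Degree<-sum {k = suc r} _ λ i →
      Degree<-scale (f (toℕ i)) (Degree<-lagrangeBasis (toℕ≤pred[n] i)))

    interpolant-node : ∀ {m} → m ≤ r → interpolant m ≈ f m * ι (r !)
    interpolant-node {m} m≤r = begin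
      interpolant m
        ≈⟨ sum-single _ node off-node ⟩
      f (toℕ node) * lagrangeBasis r (toℕ node) (ι m)
        ≡⟨ ≡.cong (λ j → f j * lagrangeBasis r j (ι m)) (toℕ-fromℕ< (s≤s m≤r)) ⟩
      f m * lagrangeBasis r m (ι m)
        ≈⟨ *-congˡ (lagrangeBasis-diagonal m≤r) ⟩
      f m * ι (r !)
        ∎
      where
      node : Fin (suc r)
      node = Fin.fromℕ< (s≤s m≤r)
      off-node : ∀ j → j ≢ node → f (toℕ j) * lagrangeBasis r (toℕ j) (ι m) ≈ 0#
      off-node j j≢node =
        trans (*-congˡ (lagrangeBasis-off-diagonal (toℕ≤pred[n] j) m≤r m≢j)) (zeroʳ _)
        where
        m≢j : m ≢ toℕ j
        m≢j m≡j = j≢node (toℕ-injective (≡.trans (≡.sym m≡j) (≡.sym (toℕ-fromℕ< (s≤s m≤r)))))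

    error-at-nodes : ∀ m → m < suc r → ι (r !) * f m - interpolant m ≈ 0#
    error-at-nodes m (s≤s m≤r) =
      trans (+-congˡ (-‿cong (trans (interpolant-node m≤r) (*-comm (f m) (ι (r !)))))) (-‿inverseʳ _)

module OrderedField (R : RealNumbers) where

  open RealNumbers R using (Carrier; _≤_; isTotalOrder; 0≢1; inverse; *-nonneg)
    renaming (+-mono-≤ to +-monoˡ-≤)
  open RealOps R using (AbsLe; fromℕ'; sumFin; IsPolyOfDegree) renaming (_^_ to _^ᴿ_)
  open IsTotalOrder isTotalOrder using (total)
    renaming (refl to ≤-refl; trans to ≤-trans; antisym to ≤-antisym)

  commutativeRing : CommutativeRing 0ℓ 0ℓ
  commutativeRing = record { isCommutativeRing = RealNumbers.isCommutativeRing R }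

  poset : Poset 0ℓ 0ℓ 0ℓ
  poset = record { isPartialOrder = IsTotalOrder.isPartialOrder isTotalOrder }

  module ≤-Reasoning = Relation.Binary.Reasoning.PartialOrder poset

  open CommutativeRing commutativeRing hiding (zero; Carrier)
  open Interpolation commutativeRing
  open import Algebra.Properties.Ring ring
    using (-‿distribˡ-*; -‿distribʳ-*; -‿involutive; -1*x≈-x; -0#≈0#)
  open import Algebra.Properties.AbelianGroup +-abelianGroup using (//-rightDividesˡ)
  open import Algebra.Properties.Semiring.Exp semiring using (_^_)
  open import Algebra.Properties.Semiring.Sum semiring using (sum; sum-cong-≋)
  import Algebra.Properties.CommutativeSemigroup ℕ.*-commutativeSemigroup as ℕ*

  x≤y⇒0≤y-x : ∀ {x y} → x ≤ y → 0# ≤ y - x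
  x≤y⇒0≤y-x {x} {y} x≤y = ≡.subst (_≤ y - x) (-‿inverseʳ x) (+-monoˡ-≤ (- x) x≤y)

  0≤y-x⇒x≤y : ∀ {x y} → 0# ≤ y - x → x ≤ y
  0≤y-x⇒x≤y {x} {y} 0≤y-x = ≡.subst₂ _≤_ (+-identityˡ x) (//-rightDividesˡ x y) (+-monoˡ-≤ x 0≤y-x)

  neg-mono-≤ : ∀ {x y} → x ≤ y → - y ≤ - x
  neg-mono-≤ {x} {y} x≤y = 0≤y-x⇒x≤y (≡.subst (0# ≤_) y-x≡-x--y (x≤y⇒0≤y-x x≤y))
    where
    y-x≡-x--y : y - x ≡ - x - - y
    y-x≡-x--y = trans (+-comm y (- x)) (+-congˡ (sym (-‿involutive y)))

  +-mono-≤ : ∀ {x y u v} → x ≤ y → u ≤ v → x + u ≤ y + v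
  +-mono-≤ {x} {y} {u} {v} x≤y u≤v =
    ≤-trans (+-monoˡ-≤ u x≤y) (≡.subst₂ _≤_ (+-comm u y) (+-comm v y) (+-monoˡ-≤ y u≤v))

  x≤0⇒0≤-x : ∀ {x} → x ≤ 0# → 0# ≤ - x
  x≤0⇒0≤-x x≤0 = ≡.subst (_≤ _) -0#≈0# (neg-mono-≤ x≤0)

  0≤1 : 0# ≤ 1#
  0≤1 with total 0# 1#
  ... | inj₁ 0≤1′ = 0≤1′
  ... | inj₂ 1≤0  = ≡.subst (0# ≤_) [-1]*[-1]≡1 (*-nonneg 0≤-1 0≤-1)
    where
    0≤-1 : 0# ≤ - 1#
    0≤-1 = x≤0⇒0≤-x 1≤0
    [-1]*[-1]≡1 : - 1# * - 1# ≡ 1#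
    [-1]*[-1]≡1 = trans (-1*x≈-x (- 1#)) (-‿involutive 1#)

  0≰-1 : ¬ (0# ≤ - 1#)
  0≰-1 0≤-1 = 0≢1 (≤-antisym 0≤1 (≡.subst₂ _≤_ (-‿involutive 1#) -0#≈0# (neg-mono-≤ 0≤-1)))

  0≤ι : ∀ n → 0# ≤ ι n
  0≤ι zero    = ≤-refl
  0≤ι (suc n) = ≡.subst (_≤ ι (suc n)) (+-identityʳ 0#) (+-mono-≤ 0≤1 (0≤ι n))

  ι-mono-≤ : ∀ {m n} → m ℕ.≤ n → ι m ≤ ι n
  ι-mono-≤ {m} {n} m≤n = ≡.subst₂ _≤_ (+-identityʳ (ι m)) ι[m+[n∸m]]≡ιn (+-mono-≤ ≤-refl (0≤ι (n ∸ m)))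
    where
    ι[m+[n∸m]]≡ιn : ι m + ι (n ∸ m) ≡ ι n
    ι[m+[n∸m]]≡ιn = trans (sym (ι-+ m (n ∸ m))) (≡.cong ι (ℕ.m+[n∸m]≡n m≤n))

  ι≢0 : ∀ n → .{{ℕ.NonZero n}} → ι n ≢ 0#
  ι≢0 (suc n) ι[1+n]≡0 =
    0≢1 (≤-antisym 0≤1 (≡.subst₂ _≤_ (+-identityʳ 1#) ι[1+n]≡0 (+-mono-≤ ≤-refl (0≤ι n))))

  *-monoˡ-≤-nonNeg : ∀ {x y} z → 0# ≤ z → x ≤ y → x * z ≤ y * z
  *-monoˡ-≤-nonNeg {x} {y} z 0≤z x≤y =
    0≤y-x⇒x≤y (≡.subst (0# ≤_) [y-x]z≡yz-xz (*-nonneg (x≤y⇒0≤y-x x≤y) 0≤z))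
    where
    [y-x]z≡yz-xz : (y - x) * z ≡ y * z - x * z
    [y-x]z≡yz-xz = trans (distribʳ z y (- x)) (+-congˡ (sym (-‿distribˡ-* x z)))

  *-cancelˡ-≤-pos : ∀ {a x y} → 0# ≤ a → a ≢ 0# → a * x ≤ a * y → x ≤ y
  *-cancelˡ-≤-pos {a} {x} {y} 0≤a a≢0 ax≤ay with inverse a a≢0
  ... | b , ab≡1 = ≡.subst₂ _≤_ (cancel x) (cancel y) (*-monoˡ-≤-nonNeg b 0≤b ax≤ay)
    where
    cancel : ∀ z → a * z * b ≡ z
    cancel z = trans (*-assoc a z b) (trans (*-congˡ (*-comm z b)) (trans (sym (*-assoc a b z))
                 (trans (*-congʳ ab≡1) (*-identityˡ z))))
    0≤b : 0# ≤ b
    0≤b with total 0# b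
    ... | inj₁ 0≤b = 0≤b
    ... | inj₂ b≤0 = ⊥-elim (0≰-1 (≡.subst (0# ≤_) a[-b]≡-1 (*-nonneg 0≤a (x≤0⇒0≤-x b≤0))))
      where
      a[-b]≡-1 : a * - b ≡ - 1#
      a[-b]≡-1 = trans (sym (-‿distribʳ-* a b)) (-‿cong ab≡1)

  Abs-0 : ∀ {a} → 0# ≤ a → AbsLe 0# a
  Abs-0 0≤a = ≡.subst (_ ≤_) -0#≈0# (neg-mono-≤ 0≤a) , 0≤a

  Abs-mono : ∀ {x a b} → AbsLe x a → a ≤ b → AbsLe x b
  Abs-mono (-a≤x , x≤a) a≤b = ≤-trans (neg-mono-≤ a≤b) -a≤x , ≤-trans x≤a a≤b

  Abs-neg : ∀ {x a} → AbsLe x a → AbsLe (- x) a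
  Abs-neg {x} (-a≤x , x≤a) = neg-mono-≤ x≤a , ≡.subst (- x ≤_) (-‿involutive _) (neg-mono-≤ -a≤x)

  Abs-+ : ∀ {x y a b} → AbsLe x a → AbsLe y b → AbsLe (x + y) (a + b)
  Abs-+ {a = a} {b} (-a≤x , x≤a) (-b≤y , y≤b) =
    ≡.subst (_≤ _) (sym (-‿distrib-+ a b)) (+-mono-≤ -a≤x -b≤y) , +-mono-≤ x≤a y≤b

  Abs-sum : ∀ {k} {t b : Fin k → Carrier} → (∀ i → AbsLe (t i) (b i)) → AbsLe (sum t) (sum b)
  Abs-sum {zero}  _     = Abs-0 ≤-refl
  Abs-sum {suc k} bound = Abs-+ (bound Fin.zero) (Abs-sum (bound ∘ Fin.suc))

  Abs-*-nonNeg : ∀ {x a k} → 0# ≤ k → AbsLe x a → AbsLe (x * k) (a * k)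
  Abs-*-nonNeg {x} {a} {k} 0≤k (-a≤x , x≤a) =
    ≡.subst (_≤ x * k) (sym (-‿distribˡ-* a k)) (*-monoˡ-≤-nonNeg k 0≤k -a≤x) ,
    *-monoˡ-≤-nonNeg k 0≤k x≤a

  Abs-*-≈±ι : ∀ {x a y k} → AbsLe x a → y ≈±ι k → AbsLe (x * y) (a * ι k)
  Abs-*-≈±ι {x} {a} {k = k} |x|≤a (inj₁ y≡ιk) =
    ≡.subst (λ y → AbsLe (x * y) (a * ι k)) (sym y≡ιk) (Abs-*-nonNeg (0≤ι k) |x|≤a)
  Abs-*-≈±ι {x} {a} {k = k} |x|≤a (inj₂ y≡-ιk) =
    ≡.subst (λ z → AbsLe z (a * ι k)) (trans (-‿distribʳ-* x (ι k)) (*-congˡ (sym y≡-ιk)))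
            (Abs-neg (Abs-*-nonNeg (0≤ι k) |x|≤a))

  lagrange-bound : ∀ {r n M f} → Degree< (suc r) f → (∀ i → i ℕ.≤ r → AbsLe (f i) (ι M)) → r ℕ.≤ n →
                   AbsLe (ι (r !) * f n) (ι (M ℕ.* 2 ℕ.^ r ℕ.* n ℕ.^ r))
  lagrange-bound {r} {n} {M} {f} df |f|≤M r≤n =
    ≡.subst₂ AbsLe (sym (lagrange-interpolation r df n)) (trans (sym (ι-sum bound)) (≡.cong ι ∑bound≡))
      (Abs-sum {t = term} term-bound)
    where
    bound : Fin (suc r) → ℕ
    bound i = M ℕ.* ((r C toℕ i) ℕ.* n ℕ.^ r)

    term : Fin (suc r) → Carrier
    term i = f (toℕ i) * lagrangeBasis r (toℕ i) (ι n)

    term-bound : ∀ i → AbsLe (term i) (ι (bound i))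
    term-bound i with lagrangeBasis-≈±ι (toℕ≤pred[n] i) r≤n
    ... | m , m≤ , basis≈±m =
      Abs-mono (≡.subst (AbsLe (term i)) (sym (ι-* M m))
                        (Abs-*-≈±ι {k = m} (|f|≤M (toℕ i) (toℕ≤pred[n] i)) basis≈±m))
               (ι-mono-≤ (ℕ.*-monoʳ-≤ M m≤))

    ∑bound≡ : ℕΣ.sum bound ≡ M ℕ.* 2 ℕ.^ r ℕ.* n ℕ.^ r
    ∑bound≡ = begin
      ℕΣ.sum bound                                 ≡⟨ ℕΣ.*-distribˡ-sum M (λ i → binomial i ℕ.* n ℕ.^ r) ⟨
      M ℕ.* ℕΣ.sum (λ i → binomial i ℕ.* n ℕ.^ r)  ≡⟨ ≡.cong (M ℕ.*_) (ℕΣ.*-distribʳ-sum (n ℕ.^ r) binomial) ⟨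
      M ℕ.* (ℕΣ.sum binomial ℕ.* n ℕ.^ r)          ≡⟨ ≡.cong (λ s → M ℕ.* (s ℕ.* n ℕ.^ r)) (∑nCk≡2^n r) ⟩
      M ℕ.* (2 ℕ.^ r ℕ.* n ℕ.^ r)                  ≡⟨ ℕ.*-assoc M _ _ ⟨
      M ℕ.* 2 ℕ.^ r ℕ.* n ℕ.^ r                    ∎
      where
      open ≡.≡-Reasoning
      binomial : Fin (suc r) → ℕ
      binomial i = r C toℕ i

  f≤4n^r : ∀ {r n f} → Degree< (suc r) f → (∀ i → i ℕ.≤ r → AbsLe (f i) (ι 2)) → r ℕ.≤ n →
           f n ≤ ι 4 * ι n ^ r
  f≤4n^r {r} {n} {f} df |f|≤2 r≤n = *-cancelˡ-≤-pos (0≤ι (r !)) (ι≢0 (r !) {{r ℕ.!≢0}}) (begin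
    ι (r !) * f n                       ≤⟨ proj₂ (lagrange-bound {M = 2} df |f|≤2 r≤n) ⟩
    ι (2 ℕ.* 2 ℕ.^ r ℕ.* n ℕ.^ r)       ≤⟨ ι-mono-≤ (ℕ.*-monoˡ-≤ (n ℕ.^ r) (2*2^n≤4*n! r)) ⟩
    ι (4 ℕ.* r ! ℕ.* n ℕ.^ r)           ≡⟨ ≡.cong ι (ℕ.*-assoc 4 (r !) (n ℕ.^ r)) ⟩
    ι (4 ℕ.* (r ! ℕ.* n ℕ.^ r))         ≡⟨ ≡.cong ι (ℕ*.x∙yz≈y∙xz 4 (r !) (n ℕ.^ r)) ⟩
    ι (r ! ℕ.* (4 ℕ.* n ℕ.^ r))         ≡⟨ ι-* (r !) _ ⟩
    ι (r !) * ι (4 ℕ.* n ℕ.^ r)         ≡⟨ *-congˡ (trans (ι-* 4 (n ℕ.^ r)) (*-congˡ (ι-^ n r))) ⟩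
    ι (r !) * (ι 4 * ι n ^ r)           ∎)
    where open ≤-Reasoning

  fromℕ'≡ι : ∀ n → fromℕ' n ≡ ι n
  fromℕ'≡ι zero    = ≡.refl
  fromℕ'≡ι (suc n) = ≡.cong (1# +_) (fromℕ'≡ι n)

  ^ᴿ≡^ : ∀ x k → x ^ᴿ k ≡ x ^ k
  ^ᴿ≡^ x zero    = ≡.refl
  ^ᴿ≡^ x (suc k) = ≡.cong (x *_) (^ᴿ≡^ x k)

  fromℕ'^ᴿ≡ι^ : ∀ n k → fromℕ' n ^ᴿ k ≡ ι n ^ k
  fromℕ'^ᴿ≡ι^ n k = trans (^ᴿ≡^ (fromℕ' n) k) (≡.cong (_^ k) (fromℕ'≡ι n))

  sumFin≡sum : ∀ k (t : Fin k → Carrier) → sumFin k t ≡ sum t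
  sumFin≡sum zero    t = ≡.refl
  sumFin≡sum (suc k) t = ≡.cong (t Fin.zero +_) (sumFin≡sum k (t ∘ Fin.suc))

  IsPolyOfDegree⇒Degree< : ∀ {p r} → IsPolyOfDegree p r → Degree< (suc r) (λ n → p (fromℕ' n))
  IsPolyOfDegree⇒Degree< {p} {r} (a , _ , p≡∑) =
    Degree<-cong (λ n → sym (p[n]≡∑ n)) (Degree<-polynomial r a)
    where
    p[n]≡∑ : ∀ n → p (fromℕ' n) ≡ sum (λ i → a i * ι n ^ toℕ i)
    p[n]≡∑ n = trans (p≡∑ (fromℕ' n))
                     (trans (sumFin≡sum (suc r) (λ i → a i * fromℕ' n ^ᴿ toℕ i))
                            (sum-cong-≋ λ i → *-congˡ {a i} (fromℕ'^ᴿ≡ι^ n (toℕ i))))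

  polynomial-bound : ∀ {p r n} → IsPolyOfDegree p r → (∀ i → i ℕ.≤ r → AbsLe (p (fromℕ' i)) (fromℕ' 2)) →
                     r ℕ.≤ n → p (fromℕ' n) ≤ fromℕ' 4 * fromℕ' n ^ᴿ r
  polynomial-bound {p} {r} {n} p-poly |p[i]|≤2 r≤n =
    ≡.subst (λ x → p (fromℕ' n) ≤ ι 4 * x) (sym (fromℕ'^ᴿ≡ι^ n r))
            (f≤4n^r (IsPolyOfDegree⇒Degree< p-poly) |p[i]|≤2 r≤n)

open import Data.Nat using (_≤_)
open RealNumbers using (Carrier; 0#)
open RealOps

lemma2p8 : (R : RealNumbers) →
    (r N : ℕ) → r ≤ N → (p : Carrier R → Carrier R) → IsPolyOfDegree R p r →
    p (0# R) ≡ 0# R → (∀ (i : ℕ) → 1 ≤ i → i ≤ N → AbsLe R (p (fromℕ' R i)) (fromℕ' R 2)) →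
    ∀ (ℓ : ℕ) → N ≤ ℓ →
      RealNumbers._≤_ R (p (fromℕ' R ℓ)) (RealNumbers._*_ R (fromℕ' R 4) (_^_ R (fromℕ' R ℓ) r))
lemma2p8 R r N r≤N p p-poly p[0]≡0 |p[i]|≤2 ℓ N≤ℓ =
  polynomial-bound p-poly |p[i]|≤2-on-nodes (ℕ.≤-trans r≤N N≤ℓ)
  where
  open OrderedField R
  |p[i]|≤2-on-nodes : ∀ i → i ≤ r → AbsLe R (p (fromℕ' R i)) (fromℕ' R 2)
  |p[i]|≤2-on-nodes zero    _     = ≡.subst (λ y → AbsLe R y (fromℕ' R 2)) (≡.sym p[0]≡0) (Abs-0 (0≤ι 2))
  |p[i]|≤2-on-nodes (suc i) 1+i≤r = |p[i]|≤2 (suc i) (s≤s z≤n) (ℕ.≤-trans 1+i≤r r≤N)
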